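{- Let $G$ be a graph with reflective symmetry, with involution $\phi$, and $f^t$ as described, reduced mod 2: $f^t:(\mathbf{Z}/2)E\to(\mathbf{Z}/2)E_+\oplus(\mathbf{Z}/2)E_-$. Then $\ker(f^t)$ has basis $\{e+\phi(e): e\in E_L\}$, and the kernel of the restriction of $f^t$ to the bicycle space $Z_2(G)\cap B_2(G)$ consists exactly of the $\phi$-fixed elements of $Z_2(G)\cap B_2(G)$.
   Context: A graph with reflective symmetry is a finite graph $G=(V,E)$ with a distinguished non-degenerate drawing in $\mathbf{R}^2$ such that (1) reflection about a line $\ell$ maps the drawing into itself, and (2) every edge fixed by this reflection is fixed pointwise. The reflection induces an involution $\phi$ on $V$ and $E$, giving partitions $E=E_L\cup E^\phi\cup E_R$ (left edges, $\phi$-fixed edges, right edges) and $V=V_L\cup V^\phi\cup V_R$. $G_+=(V_+,E_+)$ is obtained from the subgraph with edge set $E_L\cup E^\phi$ (vertices = endpoints) by subdividing each edge $e_0\in E^\phi$ into two edges $e_0',e_0''$ through a new vertex; $G_-=(V_-,E_-)$ is obtained from the subgraph with edge set $E_R$ by identifying its $\phi$-fixed vertices to a single vertex. Non-subdivided edges of $E_+$ are identified with edges of $E_L$, and edges of $E_-$ with edges of $E_R$. The mod-2 map $f^t$ is the linear map with $f^t(e_0)=(e_0'+e_0'',0)$ for $e_0\in E^\phi$, $f^t(e)=(e,\phi(e))$ for $e\in E_L$ (here $\phi(e)\in E_R=E_-$), and $f^t(e)=(\phi(e),e)$ for $e\in E_R$. For a graph $H$, $Z_2(H)=\ker(\partial:(\mathbf{Z}/2)E_H\to(\mathbf{Z}/2)V_H)$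 and $B_2(H)=\operatorname{im}(\partial^t)$ mod 2, where $\partial$ is the boundary map and $\partial^t$ its transpose; $Z_2(H)\cap B_2(H)$ is the bicycle space. $\phi$ acts on $(\mathbf{Z}/2)E$ by permuting edges. -}

module Defs where

open import Data.Nat using (ℕ; zero; suc; _<_)
open import Data.Fin using (Fin; zero; suc)
open import Data.Fin.Properties using (_≟_)
open import Data.Bool using (Bool; true; false; _∧_; _xor_; if_then_else_)
open import Data.Product using (Σ; _×_; _,_; proj₁; proj₂; ∃)
open import Data.Sum using (_⊎_)
open import Relation.Nullary using (¬_)
open import Relation.Nullary.Decidable using (⌊_⌋)
open import Relation.Binary.PropositionalEquality using (_≡_; _≢_)
open import Function.Bundles using (_⇔_)

data Side : Set where
  L M R : Side          -- left, on the line (φ-fixed), right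

flipSide : Side → Side
flipSide L = R
flipSide M = M
flipSide R = L

isL : Side → Bool
isL L = true
isL M = false
isL R = false

Between : ℕ → ℕ → ℕ → Set
Between a b c = (a < b × b < c) ⊎ (c < b × b < a)

-- A (multi)graph with reflective symmetry, described combinatorially.
-- Vertices Fin nV, edges Fin nE, each edge e has (unordered) endpoints
-- src e, tgt e (loops and multiple edges allowed).

record ReflGraph : Set where
  field
    nV nE  : ℕ
    src tgt : Fin nE → Fin nV
    φV : Fin nV → Fin nV
    φE : Fin nE → Fin nE
    φV-invol : ∀ v → φV (φV v) ≡ v
    φE-invol : ∀ e → φE (φE e) ≡ e
    φ-incid : ∀ e → (src (φE e) ≡ φV (src e) × tgt (φE e) ≡ φV (tgt e))
                  ⊎ (src (φE e) ≡ φV (tgt e) × tgt (φE e) ≡ φV (src e))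
    sideV : Fin nV → Side
    sideE : Fin nE → Side
    sideV-φ : ∀ v → sideV (φV v) ≡ flipSide (sideV v)
    sideE-φ : ∀ e → sideE (φE e) ≡ flipSide (sideE e)
    fixV : ∀ v → sideV v ≡ M ⇔ φV v ≡ v
    fixE : ∀ e → sideE e ≡ M ⇔ φE e ≡ e
    -- (2) φ-fixed edges are fixed pointwise, i.e. lie in ℓ: endpoints on ℓ
    fixE-pointwise : ∀ e → sideE e ≡ M → sideV (src e) ≡ M × sideV (tgt e) ≡ M
    left-closed : ∀ e → sideE e ≡ L → sideV (src e) ≢ R × sideV (tgt e) ≢ R
    -- non-degenerate drawing on the line ℓ: vertices on ℓ have distinct
    -- positions; an edge in ℓ is the segment between its two (distinct)
    -- endpoints, containing no other vertex; distinct edges in ℓ do not overlap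
    pos : Fin nV → ℕ
    pos-inj : ∀ u v → sideV u ≡ M → sideV v ≡ M → pos u ≡ pos v → u ≡ v
    fixE-segment : ∀ e → sideE e ≡ M →
                   (pos (src e) < pos (tgt e)) ⊎ (pos (tgt e) < pos (src e))
    fixE-empty : ∀ e w → sideE e ≡ M → sideV w ≡ M →
                 ¬ Between (pos (src e)) (pos w) (pos (tgt e))
    fixE-distinct : ∀ e e' → sideE e ≡ M → sideE e' ≡ M →
                    ((src e ≡ src e' × tgt e ≡ tgt e') ⊎ (src e ≡ tgt e' × tgt e ≡ src e')) →
                    e ≡ e'

-- Mod 2 linear algebra: vectors in (Z/2)A are functions A → Bool.

lin : ∀ {A : Set} {n : ℕ} → (Fin n → Bool) → (Fin n → (A → Bool)) → A → Bool
lin {n = zero}  c v a = false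
lin {n = suc n} c v a = (c zero ∧ v zero a) xor lin (λ i → c (suc i)) (λ i → v (suc i)) a

_⊕_ : ∀ {A : Set} → (A → Bool) → (A → Bool) → A → Bool
(x ⊕ y) a = x a xor y a

module _ (G : ReflGraph) where
  open ReflGraph G

  δV : Fin nV → Fin nV → Bool
  δV v w = ⌊ v ≟ w ⌋

  δE : Fin nE → Fin nE → Bool
  δE e e' = ⌊ e ≟ e' ⌋

  ∂ : (Fin nE → Bool) → Fin nV → Bool
  ∂ x = lin x (λ e → δV (src e) ⊕ δV (tgt e))

  ∂ᵗ : (Fin nV → Bool) → Fin nE → Bool
  ∂ᵗ y = lin y (λ v e → δV (src e) v xor δV (tgt e) v)

  Z₂ : (Fin nE → Bool) → Set
  Z₂ x = ∀ v → ∂ x v ≡ false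

  B₂ : (Fin nE → Bool) → Set
  B₂ x = ∃ λ (y : Fin nV → Bool) → ∀ e → x e ≡ ∂ᵗ y e

  Bicycle : (Fin nE → Bool) → Set
  Bicycle x = Z₂ x × B₂ x

  φ· : (Fin nE → Bool) → Fin nE → Bool
  φ· x e = x (φE e)

  PhiFixed : (Fin nE → Bool) → Set
  PhiFixed x = ∀ e → φ· x e ≡ x e

  -- Edge set E₊ of G₊: left edges, and the two halves e₀', e₀'' (tagged
  -- false/true) of each subdivided edge e₀ ∈ E^φ
  data E₊ : Set where
    lft : (e : Fin nE) → sideE e ≡ L → E₊
    sub : (e : Fin nE) → sideE e ≡ M → Bool → E₊

  E₋ : Set
  E₋ = Σ (Fin nE) (λ e → sideE e ≡ R)

  δ₊L : Fin nE → E₊ → Bool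
  δ₊L e (lft e' _)   = ⌊ e ≟ e' ⌋
  δ₊L e (sub _ _ _)  = false

  δ₊S : Fin nE → Bool → E₊ → Bool
  δ₊S e b (lft _ _)     = false
  δ₊S e b (sub e' _ b') = ⌊ e ≟ e' ⌋ ∧ (if b then b' else (if b' then false else true))

  δ₋ : Fin nE → E₋ → Bool
  δ₋ e (e' , _) = ⌊ e ≟ e' ⌋

  zero₋ : E₋ → Bool
  zero₋ _ = false

  ftGen : Fin nE → (E₊ → Bool) × (E₋ → Bool)
  ftGen e with sideE e
  ... | L = δ₊L e , δ₋ (φE e)
  ... | M = δ₊S e false ⊕ δ₊S e true , zero₋
  ... | R = δ₊L (φE e) , δ₋ e

  ft : (Fin nE → Bool) → (E₊ → Bool) × (E₋ → Bool)
  ft x = lin x (λ e → proj₁ (ftGen e)) , lin x (λ e → proj₂ (ftGen e))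

  InKer : (Fin nE → Bool) → Set
  InKer x = (∀ p → proj₁ (ft x) p ≡ false) × (∀ m → proj₂ (ft x) m ≡ false)

  kerVec : Fin nE → Fin nE → Bool
  kerVec e = δE e ⊕ δE (φE e)

  leftComb : (Fin nE → Bool) → Fin nE → Bool
  leftComb c = lin (λ e → c e ∧ isL (sideE e)) kerVec

  KerBasis : Set
  KerBasis =
      (∀ e → sideE e ≡ L → InKer (kerVec e))
    × (∀ c → (∀ e → leftComb c e ≡ false) → ∀ e → sideE e ≡ L → c e ≡ false)
    × (∀ x → InKer x → ∃ λ c → ∀ e → x e ≡ leftComb c e)

module Submission where

-- Coordinatewise, f^t x reads x(e) + x(φ e) on a left edge e, x(φ e) + x(e) on a right
-- edge e, and x(e₀) on both halves of an axis edge e₀.  Hence ker f^t consists of the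
-- φ-fixed vectors vanishing on E^φ, and such an x equals Σ_{e ∈ E_L} x(e) (e + φ e).
--
-- For the bicycle space only the cycle condition matters.  Let x be a φ-fixed cycle.  At
-- a vertex u on ℓ, the left and right edges contribute equally to ∂x(u), so ∂x(u) only
-- counts the axis edges of the support of x at u.  The axis edges are non-overlapping
-- segments of ℓ, so at most one of them leaves u to the right.  Taking for u the left end
-- of the leftmost axis edge in the support of x, that edge is then the only one counted,
-- contradicting ∂x(u) = 0.

open import Defs
open import Algebra.Bundles using (CommutativeRing)
open import Data.Bool using (Bool; true; false; _∧_; _xor_; if_then_else_)
open import Data.Bool.Properties
  using (xor-∧-commutativeRing; xor-comm; xor-same; xor-identityʳ;
         ∧-zeroʳ; ∧-identityʳ; ∧-distribˡ-xor)
open import Data.Empty using (⊥; ⊥-elim)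
open import Data.Fin using (Fin; zero; suc)
open import Data.Fin.Properties using (_≟_; suc-injective)
open import Data.Fin.Permutation using (permutation)
open import Data.Nat using (ℕ; _<_)
open import Data.Nat.Induction using (<-rec)
open import Data.Nat.Properties using (<-cmp; <-irrefl)
open import Data.Product using (∃; _×_; _,_; proj₁; proj₂)
open import Data.Sum using (_⊎_; inj₁; inj₂; swap)
open import Function.Base using (_∘_)
open import Function.Bundles using (_⇔_; mk⇔; Equivalence)
open import Relation.Binary.Definitions using (tri<; tri≈; tri>)
open import Relation.Binary.PropositionalEquality
open import Relation.Nullary using (yes; no)
open import Relation.Nullary.Decidable using (⌊_⌋; isYes≗does; dec-true; dec-false)

open import Algebra.Properties.Semiring.Sum (CommutativeRing.semiring xor-∧-commutativeRing)
  using (sum; sum-cong-≗; sum-replicate-zero; ∑-distrib-+; sum-permute)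

xor≡false⇒≡ : ∀ a b → a xor b ≡ false → a ≡ b
xor≡false⇒≡ false false _ = refl
xor≡false⇒≡ true  true  _ = refl

xor-cancelʳ : ∀ a b → (a xor b) xor a ≡ b
xor-cancelʳ false false = refl
xor-cancelʳ false true  = refl
xor-cancelʳ true  false = refl
xor-cancelʳ true  true  = refl

module _ {n : ℕ} where

  ≟-≢ : {a b : Fin n} → a ≢ b → ⌊ a ≟ b ⌋ ≡ false
  ≟-≢ {a} {b} a≢b = trans (isYes≗does (a ≟ b)) (dec-false (a ≟ b) a≢b)

  ≟-refl : (a : Fin n) → ⌊ a ≟ a ⌋ ≡ true
  ≟-refl a = trans (isYes≗does (a ≟ a)) (dec-true (a ≟ a) refl)

lin≡sum : ∀ {A : Set} {n} (c : Fin n → Bool) (v : Fin n → A → Bool) a →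
          lin c v a ≡ sum (λ i → c i ∧ v i a)
lin≡sum {n = ℕ.zero}  c v a = refl
lin≡sum {n = ℕ.suc n} c v a = cong ((c zero ∧ v zero a) xor_) (lin≡sum (c ∘ suc) (v ∘ suc) a)

sum-zero : ∀ {n} {f : Fin n → Bool} → (∀ i → f i ≡ false) → sum f ≡ false
sum-zero {n} f≡0 = trans (sum-cong-≗ f≡0) (sum-replicate-zero n)

sum-supportedAt : ∀ {n} {f : Fin n → Bool} a → (∀ i → i ≢ a → f i ≡ false) → sum f ≡ f a
sum-supportedAt {f = f} zero off =
  trans (cong (f zero xor_) (sum-zero (λ i → off (suc i) λ ()))) (xor-identityʳ (f zero))
sum-supportedAt {f = f} (suc a) off =
  trans (cong (_xor sum (f ∘ suc)) (off zero λ ()))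
        (sum-supportedAt a (λ i i≢a → off (suc i) (i≢a ∘ suc-injective)))

sum-∧-≟ : ∀ {n} (f : Fin n → Bool) a → sum (λ i → f i ∧ ⌊ i ≟ a ⌋) ≡ f a
sum-∧-≟ f a =
  trans (sum-supportedAt a (λ i i≢a → trans (cong (f i ∧_) (≟-≢ i≢a)) (∧-zeroʳ (f i))))
        (trans (cong (f a ∧_) (≟-refl a)) (∧-identityʳ (f a)))

sum-∧-≟-xor : ∀ {n} (f : Fin n → Bool) a b →
              sum (λ i → f i ∧ (⌊ i ≟ a ⌋ xor ⌊ i ≟ b ⌋)) ≡ f a xor f b
sum-∧-≟-xor f a b = begin
  sum (λ i → f i ∧ (⌊ i ≟ a ⌋ xor ⌊ i ≟ b ⌋))
    ≡⟨ sum-cong-≗ (λ i → ∧-distribˡ-xor (f i) _ _) ⟩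
  sum (λ i → (f i ∧ ⌊ i ≟ a ⌋) xor (f i ∧ ⌊ i ≟ b ⌋))
    ≡⟨ ∑-distrib-+ (λ i → f i ∧ ⌊ i ≟ a ⌋) (λ i → f i ∧ ⌊ i ≟ b ⌋) ⟩
  sum (λ i → f i ∧ ⌊ i ≟ a ⌋) xor sum (λ i → f i ∧ ⌊ i ≟ b ⌋)
    ≡⟨ cong₂ _xor_ (sum-∧-≟ f a) (sum-∧-≟ f b) ⟩
  f a xor f b ∎
  where open ≡-Reasoning

isM isR : Side → Bool
isM L = false
isM M = true
isM R = false
isR L = false
isR M = false
isR R = true

isR-flipSide : ∀ s → isR (flipSide s) ≡ isL s
isR-flipSide L = refl
isR-flipSide M = refl
isR-flipSide R = refl

splitBySide : ∀ s b → b ≡ ((isL s ∧ b) xor (isM s ∧ b)) xor (isR s ∧ b)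
splitBySide L false = refl
splitBySide L true  = refl
splitBySide M false = refl
splitBySide M true  = refl
splitBySide R false = refl
splitBySide R true  = refl

module _ {n : ℕ} (σ : Fin n → Fin n) (σ-invol : ∀ i → σ (σ i) ≡ i) where

  ≟-involution : ∀ a b → ⌊ σ a ≟ b ⌋ ≡ ⌊ a ≟ σ b ⌋
  ≟-involution a b with σ a ≟ b | a ≟ σ b
  ... | yes _ | yes _ = refl
  ... | no  _ | no  _ = refl
  ... | yes σa≡b | no  a≢σb = ⊥-elim (a≢σb (trans (sym (σ-invol a)) (cong σ σa≡b)))
  ... | no  σa≢b | yes a≡σb = ⊥-elim (σa≢b (trans (cong σ a≡σb) (σ-invol b)))

  ≟-fixedPoint : ∀ a {u} → σ u ≡ u → ⌊ σ a ≟ u ⌋ ≡ ⌊ a ≟ u ⌋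
  ≟-fixedPoint a {u} σu≡u = trans (≟-involution a u) (cong (λ t → ⌊ a ≟ t ⌋) σu≡u)

  ≟-involution² : ∀ a b → ⌊ σ a ≟ σ b ⌋ ≡ ⌊ a ≟ b ⌋
  ≟-involution² a b = trans (≟-involution a (σ b)) (cong (λ t → ⌊ a ≟ t ⌋) (σ-invol b))

  sum-∘-involution : (f : Fin n → Bool) → sum (f ∘ σ) ≡ sum f
  sum-∘-involution f = sym (sum-permute f (permutation σ σ σ-invol σ-invol))

  sum-invariant≡sum-middle : (side : Fin n → Side) → (∀ i → side (σ i) ≡ flipSide (side i)) →
                             (g : Fin n → Bool) → (∀ i → g (σ i) ≡ g i) →
                             sum g ≡ sum (λ i → isM (side i) ∧ g i)
  sum-invariant≡sum-middle side side-σ g g-σ = begin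
    sum g
      ≡⟨ sum-cong-≗ (λ i → splitBySide (side i) (g i)) ⟩
    sum (λ i → (left i xor middle i) xor right i)
      ≡⟨ ∑-distrib-+ (λ i → left i xor middle i) right ⟩
    sum (λ i → left i xor middle i) xor sum right
      ≡⟨ cong₂ _xor_ (∑-distrib-+ left middle) right≡left ⟩
    (sum left xor sum middle) xor sum left
      ≡⟨ xor-cancelʳ (sum left) (sum middle) ⟩
    sum middle ∎
    where
    open ≡-Reasoning
    left middle right : Fin n → Bool
    left   i = isL (side i) ∧ g i
    middle i = isM (side i) ∧ g i
    right  i = isR (side i) ∧ g i
    right≡left : sum right ≡ sum left
    right≡left = trans (sym (sum-∘-involution right))
      (sum-cong-≗ (λ i → cong₂ _∧_ (trans (cong isR (side-σ i)) (isR-flipSide (side i))) (g-σ i)))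

module _ (G : ReflGraph) where
  open ReflGraph G

  VanishesOnAxis : (Fin nE → Bool) → Set
  VanishesOnAxis x = ∀ e → sideE e ≡ M → x e ≡ false

  sideE-φ≡ : ∀ {e s} → sideE e ≡ s → sideE (φE e) ≡ flipSide s
  sideE-φ≡ {e} refl = sideE-φ e

  ≟-bySide : ∀ {a b s t} → sideE a ≡ s → sideE b ≡ t → s ≢ t → ⌊ a ≟ b ⌋ ≡ false
  ≟-bySide a-s b-t s≢t = ≟-≢ (λ a≡b → s≢t (trans (sym a-s) (trans (cong sideE a≡b) b-t)))

  oneOfTwoHalves : ∀ d b → (d ∧ (if b then false else true)) xor (d ∧ b) ≡ d
  oneOfTwoHalves false b     = refl
  oneOfTwoHalves true  false = refl
  oneOfTwoHalves true  true  = refl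

  ftGen₊-lft : ∀ e e' (h : sideE e' ≡ L) →
               proj₁ (ftGen G e) (lft e' h) ≡ ⌊ e ≟ e' ⌋ xor ⌊ e ≟ φE e' ⌋
  ftGen₊-lft e e' h with sideE e in e-s
  ... | L rewrite ≟-bySide e-s (sideE-φ≡ h) (λ ()) = sym (xor-identityʳ _)
  ... | M rewrite ≟-bySide e-s h (λ ()) | ≟-bySide e-s (sideE-φ≡ h) (λ ()) = refl
  ... | R rewrite ≟-bySide e-s h (λ ()) = ≟-involution φE φE-invol e e'

  ftGen₊-sub : ∀ e e' (h : sideE e' ≡ M) b → proj₁ (ftGen G e) (sub e' h b) ≡ ⌊ e ≟ e' ⌋
  ftGen₊-sub e e' h b with sideE e in e-s
  ... | L = sym (≟-bySide e-s h (λ ()))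
  ... | M = oneOfTwoHalves ⌊ e ≟ e' ⌋ b
  ... | R = sym (≟-bySide e-s h (λ ()))

  ftGen₋ : ∀ e e' (h : sideE e' ≡ R) → proj₂ (ftGen G e) (e' , h) ≡ ⌊ e ≟ φE e' ⌋ xor ⌊ e ≟ e' ⌋
  ftGen₋ e e' h with sideE e in e-s
  ... | L rewrite ≟-bySide e-s h (λ ()) =
    trans (≟-involution φE φE-invol e e') (sym (xor-identityʳ _))
  ... | M rewrite ≟-bySide e-s h (λ ()) | ≟-bySide e-s (sideE-φ≡ h) (λ ()) = refl
  ... | R rewrite ≟-bySide e-s (sideE-φ≡ h) (λ ()) = refl

  ft₊-lft : ∀ x e (h : sideE e ≡ L) → proj₁ (ft G x) (lft e h) ≡ x e xor x (φE e)
  ft₊-lft x e h = trans (lin≡sum x _ _)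
    (trans (sum-cong-≗ (λ i → cong (x i ∧_) (ftGen₊-lft i e h))) (sum-∧-≟-xor x e (φE e)))

  ft₊-sub : ∀ x e (h : sideE e ≡ M) b → proj₁ (ft G x) (sub e h b) ≡ x e
  ft₊-sub x e h b = trans (lin≡sum x _ _)
    (trans (sum-cong-≗ (λ i → cong (x i ∧_) (ftGen₊-sub i e h b))) (sum-∧-≟ x e))

  ft₋ : ∀ x e (h : sideE e ≡ R) → proj₂ (ft G x) (e , h) ≡ x (φE e) xor x e
  ft₋ x e h = trans (lin≡sum x _ _)
    (trans (sum-cong-≗ (λ i → cong (x i ∧_) (ftGen₋ i e h))) (sum-∧-≟-xor x (φE e) e))

  inKer⇔phiFixed×vanishesOnAxis : ∀ x → InKer G x ⇔ (PhiFixed G x × VanishesOnAxis x)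
  inKer⇔phiFixed×vanishesOnAxis x = mk⇔ (λ ker → phiFixed ker , vanishes ker) inKer
    where
    phiFixed : InKer G x → PhiFixed G x
    phiFixed ker e with sideE e in e-s
    ... | L = sym (xor≡false⇒≡ (x e) (x (φE e)) (trans (sym (ft₊-lft x e e-s)) (proj₁ ker (lft e e-s))))
    ... | M = cong x (Equivalence.to (fixE e) e-s)
    ... | R = xor≡false⇒≡ (x (φE e)) (x e) (trans (sym (ft₋ x e e-s)) (proj₂ ker (e , e-s)))
    vanishes : InKer G x → VanishesOnAxis x
    vanishes ker e h = trans (sym (ft₊-sub x e h false)) (proj₁ ker (sub e h false))
    inKer : PhiFixed G x × VanishesOnAxis x → InKer G x
    inKer (fixed , zero-on-axis) = ker₊ , ker₋
      where
      ker₊ : ∀ p → proj₁ (ft G x) p ≡ false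
      ker₊ (lft e h)   = trans (ft₊-lft x e h) (trans (cong (x e xor_) (fixed e)) (xor-same (x e)))
      ker₊ (sub e h b) = trans (ft₊-sub x e h b) (zero-on-axis e h)
      ker₋ : ∀ m → proj₂ (ft G x) m ≡ false
      ker₋ (e , h) = trans (ft₋ x e h) (trans (cong (_xor x e) (fixed e)) (xor-same (x e)))

  leftPart : (Fin nE → Bool) → Fin nE → Bool
  leftPart c a = c a ∧ isL (sideE a)

  leftComb≡ : ∀ c e → leftComb G c e ≡ leftPart c e xor leftPart c (φE e)
  leftComb≡ c e = trans (lin≡sum (leftPart c) (kerVec G) e)
    (trans (sum-cong-≗ (λ a → cong (λ t → leftPart c a ∧ (⌊ a ≟ e ⌋ xor t)) (≟-involution φE φE-invol a e)))
           (sum-∧-≟-xor (leftPart c) e (φE e)))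

  leftPart-lft : ∀ c {e} → sideE e ≡ L → leftPart c e ≡ c e
  leftPart-lft c {e} h rewrite h = ∧-identityʳ (c e)

  leftPart-notLeft : ∀ c {e s} → sideE e ≡ s → s ≢ L → leftPart c e ≡ false
  leftPart-notLeft c {e} {L} h s≢L = ⊥-elim (s≢L refl)
  leftPart-notLeft c {e} {M} h s≢L rewrite h = ∧-zeroʳ (c e)
  leftPart-notLeft c {e} {R} h s≢L rewrite h = ∧-zeroʳ (c e)

  kerVec-inKer : ∀ e → sideE e ≡ L → InKer G (kerVec G e)
  kerVec-inKer e h = Equivalence.from (inKer⇔phiFixed×vanishesOnAxis (kerVec G e)) (fixed , zero-on-axis)
    where
    fixed : PhiFixed G (kerVec G e)
    fixed e' = trans (cong₂ _xor_ (sym (≟-involution φE φE-invol e e')) (≟-involution² φE φE-invol e e'))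
                     (xor-comm ⌊ φE e ≟ e' ⌋ ⌊ e ≟ e' ⌋)
    zero-on-axis : VanishesOnAxis (kerVec G e)
    zero-on-axis e' h' = cong₂ _xor_ (≟-bySide h h' (λ ())) (≟-bySide (sideE-φ≡ h) h' (λ ()))

  leftComb-independent : ∀ c → (∀ e → leftComb G c e ≡ false) → ∀ e → sideE e ≡ L → c e ≡ false
  leftComb-independent c comb≡0 e h = begin
    c e                                        ≡⟨ sym (leftPart-lft c h) ⟩
    leftPart c e                               ≡⟨ sym (xor-identityʳ _) ⟩
    leftPart c e xor false                     ≡⟨ cong (leftPart c e xor_) (sym (leftPart-notLeft c (sideE-φ≡ h) (λ ()))) ⟩
    leftPart c e xor leftPart c (φE e)         ≡⟨ sym (leftComb≡ c e) ⟩
    leftComb G c e                             ≡⟨ comb≡0 e ⟩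
    false ∎
    where open ≡-Reasoning

  inKer⇒leftComb : ∀ x → InKer G x → ∀ e → x e ≡ leftComb G x e
  inKer⇒leftComb x ker e = trans (bySide (sideE e) refl) (sym (leftComb≡ x e))
    where
    fixed : PhiFixed G x
    fixed = proj₁ (Equivalence.to (inKer⇔phiFixed×vanishesOnAxis x) ker)
    zero-on-axis : VanishesOnAxis x
    zero-on-axis = proj₂ (Equivalence.to (inKer⇔phiFixed×vanishesOnAxis x) ker)
    bySide : ∀ s → sideE e ≡ s → x e ≡ leftPart x e xor leftPart x (φE e)
    bySide L e-s = sym (trans (cong₂ _xor_ (leftPart-lft x e-s) (leftPart-notLeft x (sideE-φ≡ e-s) (λ ())))
                              (xor-identityʳ (x e)))
    bySide M e-s = trans (zero-on-axis e e-s)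
      (sym (cong₂ _xor_ (leftPart-notLeft x e-s (λ ())) (leftPart-notLeft x (sideE-φ≡ e-s) (λ ()))))
    bySide R e-s = sym (trans (cong₂ _xor_ (leftPart-notLeft x e-s (λ ())) (leftPart-lft x (sideE-φ≡ e-s)))
                              (fixed e))

  kerBasis : KerBasis G
  kerBasis = kerVec-inKer , leftComb-independent , λ x ker → x , inKer⇒leftComb x ker

  -- φ-fixed cycles vanish on the axis

  Joins : Fin nE → Fin nV → Fin nV → Set
  Joins e u w = (src e ≡ u × tgt e ≡ w) ⊎ (src e ≡ w × tgt e ≡ u)

  incidence : Fin nE → Fin nV → Bool
  incidence e u = ⌊ src e ≟ u ⌋ xor ⌊ tgt e ≟ u ⌋

  incidence-φ : ∀ e {u} → φV u ≡ u → incidence (φE e) u ≡ incidence e u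
  incidence-φ e {u} u-fixed with φ-incid e
  ... | inj₁ (s≡ , t≡) rewrite s≡ | t≡ =
    cong₂ _xor_ (≟-fixedPoint φV φV-invol (src e) u-fixed) (≟-fixedPoint φV φV-invol (tgt e) u-fixed)
  ... | inj₂ (s≡ , t≡) rewrite s≡ | t≡ =
    trans (cong₂ _xor_ (≟-fixedPoint φV φV-invol (tgt e) u-fixed) (≟-fixedPoint φV φV-invol (src e) u-fixed))
          (xor-comm ⌊ tgt e ≟ u ⌋ ⌊ src e ≟ u ⌋)

  incidence≡true⇒joins : ∀ e u → incidence e u ≡ true → ∃ λ w → w ≢ u × Joins e u w
  incidence≡true⇒joins e u inc with src e ≟ u | tgt e ≟ u
  incidence≡true⇒joins e u () | yes _   | yes _
  incidence≡true⇒joins e u _  | yes s≡u | no t≢u = tgt e , t≢u , inj₁ (s≡u , refl)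
  incidence≡true⇒joins e u _  | no s≢u  | yes t≡u = src e , s≢u , inj₂ (refl , t≡u)
  incidence≡true⇒joins e u () | no _    | no _

  joins⇒incidence≡true : ∀ {e u w} → Joins e u w → w ≢ u → incidence e u ≡ true
  joins⇒incidence≡true {e} (inj₁ (refl , refl)) w≢u = cong₂ _xor_ (≟-refl (src e)) (≟-≢ w≢u)
  joins⇒incidence≡true {e} (inj₂ (refl , refl)) w≢u = cong₂ _xor_ (≟-≢ w≢u) (≟-refl (tgt e))

  boundary≡axisContribution : ∀ x {u} → PhiFixed G x → sideV u ≡ M →
                              ∂ G x u ≡ sum (λ e → isM (sideE e) ∧ (x e ∧ incidence e u))
  boundary≡axisContribution x {u} fixed u-M =
    trans (lin≡sum x _ u)
      (sum-invariant≡sum-middle φE φE-invol sideE sideE-φ (λ e → x e ∧ incidence e u)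
        (λ e → cong₂ _∧_ (fixed e) (incidence-φ e (Equivalence.to (fixV u) u-M))))

  joins-onAxis : ∀ {e u w} → sideE e ≡ M → Joins e u w → sideV w ≡ M
  joins-onAxis {e} e-M (inj₁ (_ , refl)) = proj₂ (fixE-pointwise e e-M)
  joins-onAxis {e} e-M (inj₂ (refl , _)) = proj₁ (fixE-pointwise e e-M)

  axisEdge-noInnerVertex : ∀ {e u w m} → sideE e ≡ M → Joins e u w → sideV m ≡ M →
                           pos u < pos m → pos m < pos w → ⊥
  axisEdge-noInnerVertex {e} e-M (inj₁ (refl , refl)) m-M u<m m<w = fixE-empty e _ e-M m-M (inj₁ (u<m , m<w))
  axisEdge-noInnerVertex {e} e-M (inj₂ (refl , refl)) m-M u<m m<w = fixE-empty e _ e-M m-M (inj₂ (u<m , m<w))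

  joins-sameEnds : ∀ {e e' u w} → sideE e ≡ M → sideE e' ≡ M → Joins e u w → Joins e' u w → e ≡ e'
  joins-sameEnds {e} {e'} e-M e'-M j j' = fixE-distinct e e' e-M e'-M (sameEnds j j')
    where
    sameEnds : ∀ {u w} → Joins e u w → Joins e' u w →
               (src e ≡ src e' × tgt e ≡ tgt e') ⊎ (src e ≡ tgt e' × tgt e ≡ src e')
    sameEnds (inj₁ (refl , refl)) (inj₁ (p , q)) = inj₁ (sym p , sym q)
    sameEnds (inj₁ (refl , refl)) (inj₂ (p , q)) = inj₂ (sym q , sym p)
    sameEnds (inj₂ (refl , refl)) (inj₁ (p , q)) = inj₂ (sym q , sym p)
    sameEnds (inj₂ (refl , refl)) (inj₂ (p , q)) = inj₁ (sym p , sym q)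

  rightward-unique : ∀ {e e' u w w'} → sideE e ≡ M → sideE e' ≡ M → Joins e u w → Joins e' u w' →
                     pos u < pos w → pos u < pos w' → e ≡ e'
  rightward-unique {e} {u = u} e-M e'-M j j' u<w u<w' with <-cmp (pos _) (pos _)
  ... | tri< w<w' _ _ = ⊥-elim (axisEdge-noInnerVertex e'-M j' (joins-onAxis e-M j) u<w w<w')
  ... | tri≈ _ w≡w' _ =
    joins-sameEnds e-M e'-M (subst (Joins e u) (pos-inj _ _ (joins-onAxis e-M j) (joins-onAxis e'-M j') w≡w') j) j'
  ... | tri> _ _ w'<w = ⊥-elim (axisEdge-noInnerVertex e-M j (joins-onAxis e'-M j') u<w' w'<w)

  module _ (x : Fin nE → Bool) (cycle : Z₂ G x) (fixed : PhiFixed G x) where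

    rightEdge-vanishes : ∀ {e u t} → sideE e ≡ M → Joins e u t → pos u < pos t →
                         (∀ {e' w} → sideE e' ≡ M → Joins e' w u → pos w < pos u → x e' ≡ false) →
                         x e ≡ false
    rightEdge-vanishes {e} {u} {t} e-M j u<t leftEdges≡0 = begin
      x e                                                  ≡⟨ sym at-e ⟩
      isM (sideE e) ∧ (x e ∧ incidence e u)                ≡⟨ sym (sum-supportedAt e others) ⟩
      sum (λ e' → isM (sideE e') ∧ (x e' ∧ incidence e' u)) ≡⟨ sym (boundary≡axisContribution x fixed u-M) ⟩
      ∂ G x u                                              ≡⟨ cycle u ⟩
      false ∎
      where
      open ≡-Reasoning
      u-M : sideV u ≡ M
      u-M = joins-onAxis e-M (swap j)
      t≢u : t ≢ u
      t≢u t≡u = <-irrefl (cong pos (sym t≡u)) u<t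
      at-e : isM (sideE e) ∧ (x e ∧ incidence e u) ≡ x e
      at-e rewrite e-M | joins⇒incidence≡true j t≢u = ∧-identityʳ (x e)
      others : ∀ e' → e' ≢ e → isM (sideE e') ∧ (x e' ∧ incidence e' u) ≡ false
      others e' e'≢e with sideE e' in e'-M
      ... | L = refl
      ... | R = refl
      ... | M with incidence e' u in inc
      ...   | false = ∧-zeroʳ (x e')
      ...   | true with incidence≡true⇒joins e' u inc
      ...     | w , w≢u , j' with <-cmp (pos w) (pos u)
      ...       | tri< w<u _ _ = cong (_∧ true) (leftEdges≡0 e'-M (swap j') w<u)
      ...       | tri≈ _ w≡u _ = ⊥-elim (w≢u (pos-inj w u (joins-onAxis e'-M j') u-M w≡u))
      ...       | tri> _ _ u<w = ⊥-elim (e'≢e (rightward-unique e'-M e-M j' j u<w u<t))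

    RightEdgesFrom : ℕ → Set
    RightEdgesFrom k = ∀ {e u t} → sideE e ≡ M → Joins e u t → pos u < pos t → pos u ≡ k → x e ≡ false

    rightEdges-vanish : ∀ k → RightEdgesFrom k
    rightEdges-vanish = <-rec RightEdgesFrom step
      where
      step : ∀ k → (∀ {k'} → k' < k → RightEdgesFrom k') → RightEdgesFrom k
      step k ih e-M j u<t refl =
        rightEdge-vanishes e-M j u<t (λ e'-M j' w<u → ih w<u e'-M j' w<u refl)

    phiFixedCycle⇒vanishesOnAxis : VanishesOnAxis x
    phiFixedCycle⇒vanishesOnAxis e e-M with fixE-segment e e-M
    ... | inj₁ s<t = rightEdges-vanish _ e-M (inj₁ (refl , refl)) s<t refl
    ... | inj₂ t<s = rightEdges-vanish _ e-M (inj₂ (refl , refl)) t<s refl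

mainTheorem5 : (G : ReflGraph) →
    KerBasis G
    × (∀ x → Bicycle G x → (InKer G x ⇔ PhiFixed G x))
mainTheorem5 G = kerBasis G , bicycleKernel
  where
  bicycleKernel : ∀ x → Bicycle G x → (InKer G x ⇔ PhiFixed G x)
  bicycleKernel x (cycle , _) =
    mk⇔ (proj₁ ∘ to) (λ fixed → from (fixed , phiFixedCycle⇒vanishesOnAxis G x cycle fixed))
    where open Equivalence (inKer⇔phiFixed×vanishesOnAxis G x)
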